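{- Let $\Gamma$ be a connected graph, $k\ge1$, and $\omega\colon E(\Gamma)\to\mathbb{Z}_k$. Let $C$ be a cycle of even length $m$ in $\Gamma$ (regarded as a closed walk). If $\gcd(\omega(C),k)=1$, then the cross-cover $\Gamma^\omega$ is connected.
   Context: For a graph $\Gamma$ and a function (weight function) $\omega\colon E(\Gamma)\to\mathbb{Z}_k$, the cross-cover $\Gamma^\omega$ is the graph with vertex set $V(\Gamma)\times\mathbb{Z}_k$ in which, for every edge $e=uv$ of $\Gamma$ and every $i\in\mathbb{Z}_k$, the vertices $(u,i)$ and $(v,\omega(e)-i)$ are adjacent. For a walk $W=(u_0,\dots,u_m)$ with edges $e_j=u_ju_{j+1}$, its weight is $\omega(W)=\sum_{j=0}^{m-1}(-1)^j\omega(e_j)\in\mathbb{Z}_k$. -}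

module Defs where

open import Data.Nat using (ℕ; suc; _+_; _≤_; NonZero; _%_)
open import Data.Fin using (Fin; toℕ)
open import Data.Bool using (Bool; T)
open import Data.Product using (_×_; _,_)
open import Data.Integer as ℤ using (ℤ; +_)
open import Data.List using (List; []; _∷_; _++_; [_]; length)
open import Data.List.Relation.Unary.Linked using (Linked)
open import Data.List.Relation.Unary.Unique.Propositional using (Unique)
open import Relation.Binary.PropositionalEquality using (_≡_)
open import Relation.Binary.Construct.Closure.ReflexiveTransitive using (Star)

record Graph : Set where
  field
    n      : ℕ
    adj    : Fin n → Fin n → Bool
    sym    : ∀ u v → adj u v ≡ adj v u
    irrefl : ∀ u → adj u u ≡ Data.Bool.false

  V : Set
  V = Fin n

  Adj : V → V → Set
  Adj u v = T (adj u v)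

open Graph public

ConnectedRel : {A : Set} → (A → A → Set) → Set
ConnectedRel {A} R = ∀ (x y : A) → Star R x y

Connected : Graph → Set
Connected G = ConnectedRel (Adj G)

-- A weight function ω : E(Γ) → ℤ_k, where ℤ_k is represented by Fin k
-- (residues 0..k-1). It is given as a function on ordered vertex pairs which
-- is symmetric on edges (its values on non-edges are irrelevant).
record Weight (G : Graph) (k : ℕ) : Set where
  field
    ω     : V G → V G → Fin k
    ω-sym : ∀ u v → Adj G u v → ω u v ≡ ω v u

open Weight public

-- The cross-cover Γ^ω: vertex set V(Γ) × ℤ_k, with (u,i) ~ (v,j) iff
-- uv ∈ E(Γ) and j = ω(uv) - i in ℤ_k, i.e. i + j ≡ ω(uv) (mod k).
CrossAdj : (G : Graph) (k : ℕ) .{{_ : NonZero k}} → Weight G k →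
           (V G × Fin k) → (V G × Fin k) → Set
CrossAdj G k W (u , i) (v , j) =
  Adj G u v × ((toℕ i + toℕ j) % k ≡ toℕ (ω W u v))

-- Weight of a walk (u₀,…,u_m) given as its vertex list:
-- Σ_j (-1)^j ω(u_j u_{j+1}), computed in ℤ (reduce mod k afterwards).
walkWeight : {G : Graph} {k : ℕ} → Weight G k → List (V G) → ℤ
walkWeight W (u ∷ v ∷ rest) = (+ toℕ (ω W u v)) ℤ.- walkWeight W (v ∷ rest)
walkWeight W _ = + 0

record Cycle (G : Graph) (m : ℕ) : Set where
  field
    start    : V G
    inner    : List (V G)
    len      : suc (length inner) ≡ m
    atLeast3 : 3 ≤ m
    distinct : Unique (start ∷ inner)

  closedWalk : List (V G)
  closedWalk = start ∷ (inner ++ [ start ])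

  field
    isWalk : Linked (Adj G) closedWalk

open Cycle public

{-# OPTIONS --safe #-}
module Submission where

-- Track the fibre coordinate of a lift as an integer x, the point being (u, x mod k).  Lifting an
-- edge uv from (u, x) lands in (v, ω(uv) − x), so two consecutive edges translate x, and the lift
-- of the even closed walk C from (h, x) returns to (h, x − ω(C)).  As ω(C) is a unit modulo k,
-- repeating the lifted cycle reaches every point of the fibre over h, and every vertex (v, j) is
-- joined to that fibre by lifting a walk from v to h.

open import Defs
open import Data.Nat using (ℕ; NonZero)
open import Data.Nat.Divisibility using (_∣_)
open import Data.Nat.GCD using (gcd)
open import Data.Integer using (_%ℕ_)
open import Relation.Binary.PropositionalEquality using (_≡_)

import Data.Nat as ℕ
import Data.Nat.Properties as ℕ
open import Data.Nat.Coprimality using (gcd≡1⇒coprime; coprime-Bézout)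
open import Data.Nat.DivMod using (_%_; m<n⇒m%n≡m)
open import Data.Nat.Divisibility using (n∣m⇒m%n≡0; ∣1⇒≡1; ∣m+n∣m⇒∣n; ∣-refl)
open import Data.Nat.GCD using (module Bézout)
open import Data.Integer using (ℤ; +_; _+_; _-_; _*_; -_; 0ℤ; 1ℤ)
open import Data.Integer.DivMod using (_/ℕ_; n%ℕd<d; a≡a%ℕn+[a/ℕn]*n)
open import Data.Integer.Divisibility.Signed
  using (divides; ∣⇒∣ᵤ; ∣m∣n⇒∣m+n; ∣m⇒∣-m; ∣n⇒∣m*n; ∣m⇒∣m*n)
  renaming (_∣_ to _∣ℤ_)
open import Data.Integer.Properties
  using (m-n≡m⊖n; ⊖-≥; pos-+; pos-*; neg-distribˡ-*; +-identityʳ; *-identityʳ)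
open import Data.Integer.Tactic.RingSolver using (solve-∀)
open import Data.Fin using (Fin; toℕ; fromℕ<)
open import Data.Fin.Properties using (toℕ-fromℕ<; fromℕ<-cong; toℕ-injective; toℕ<n)
open import Data.Bool using (T)
open import Data.Product using (∃-syntax; _×_; _,_)
open import Data.Sum using ([_,_]′)
open import Data.List using (List; []; _∷_; _++_; [_]; length)
open import Data.List.Properties using (length-++)
open import Data.List.Relation.Unary.Linked using (Linked; _∷_)
open import Function using (_∘_)
open import Level using (0ℓ)
open import Relation.Binary using (Rel; Setoid; Symmetric)
open import Relation.Binary.Construct.Closure.ReflexiveTransitive using (Star; ε; _◅_; _◅◅_; reverse)
open import Relation.Binary.PropositionalEquality as ≡ using (refl; cong; cong₂; subst; subst₂)
open import Relation.Nullary using (contradiction)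

infix 4 _≡_mod_

-- A record rather than a synonym for  + k ∣ a - b,  so that a and b are recoverable by unification.
record _≡_mod_ (a b : ℤ) (k : ℕ) : Set where
  constructor mk≡mod
  field
    divides-difference : + k ∣ℤ a - b

module _ {k : ℕ} where

  ≡mod-reflexive : ∀ {a b} → a ≡ b → a ≡ b mod k
  ≡mod-reflexive {a} refl = mk≡mod (divides 0ℤ (a-a≡0*k a (+ k)))
    where
    a-a≡0*k : ∀ a k → a - a ≡ 0ℤ * k
    a-a≡0*k = solve-∀

  ≡mod-refl : ∀ {a} → a ≡ a mod k
  ≡mod-refl = ≡mod-reflexive refl

  ≡mod-sym : ∀ {a b} → a ≡ b mod k → b ≡ a mod k
  ≡mod-sym {a} {b} (mk≡mod a≡b) = mk≡mod (subst (+ k ∣ℤ_) (-[a-b]≡b-a a b) (∣m⇒∣-m a≡b))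
    where
    -[a-b]≡b-a : ∀ a b → - (a - b) ≡ b - a
    -[a-b]≡b-a = solve-∀

  ≡mod-trans : ∀ {a b c} → a ≡ b mod k → b ≡ c mod k → a ≡ c mod k
  ≡mod-trans {a} {b} {c} (mk≡mod a≡b) (mk≡mod b≡c) =
    mk≡mod (subst (+ k ∣ℤ_) (telescope a b c) (∣m∣n⇒∣m+n a≡b b≡c))
    where
    telescope : ∀ a b c → (a - b) + (b - c) ≡ a - c
    telescope = solve-∀

  ≡mod-+ : ∀ {a b c d} → a ≡ b mod k → c ≡ d mod k → a + c ≡ b + d mod k
  ≡mod-+ {a} {b} {c} {d} (mk≡mod a≡b) (mk≡mod c≡d) =
    mk≡mod (subst (+ k ∣ℤ_) (regroup a b c d) (∣m∣n⇒∣m+n a≡b c≡d))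
    where
    regroup : ∀ a b c d → (a - b) + (c - d) ≡ (a + c) - (b + d)
    regroup = solve-∀

  ≡mod-neg : ∀ {a b} → a ≡ b mod k → - a ≡ - b mod k
  ≡mod-neg {a} {b} (mk≡mod a≡b) = mk≡mod (subst (+ k ∣ℤ_) (regroup a b) (∣m⇒∣-m a≡b))
    where
    regroup : ∀ a b → - (a - b) ≡ - a - - b
    regroup = solve-∀

  ≡mod-* : ∀ {a b c d} → a ≡ b mod k → c ≡ d mod k → a * c ≡ b * d mod k
  ≡mod-* {a} {b} {c} {d} (mk≡mod a≡b) (mk≡mod c≡d) =
    mk≡mod (subst (+ k ∣ℤ_) (regroup a b c d)
                  (∣m∣n⇒∣m+n (∣n⇒∣m*n a c≡d) (∣m⇒∣m*n d a≡b)))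
    where
    regroup : ∀ a b c d → a * (c - d) + (a - b) * d ≡ a * c - b * d
    regroup = solve-∀

  ≡mod-setoid : Setoid 0ℓ 0ℓ
  ≡mod-setoid = record
    { Carrier       = ℤ
    ; _≈_           = λ a b → a ≡ b mod k
    ; isEquivalence = record { refl = ≡mod-refl ; sym = ≡mod-sym ; trans = ≡mod-trans }
    }

module _ {k : ℕ} .{{_ : NonZero k}} where

  ≡mod⇒≡ : ∀ {r s} → r ℕ.< k → s ℕ.< k → + r ≡ + s mod k → r ≡ s
  ≡mod⇒≡ {r} {s} r<k s<k r≡s =
    [ (λ s≤r → wlog s≤r r<k r≡s) , (λ r≤s → ≡.sym (wlog r≤s s<k (≡mod-sym r≡s))) ]′
      (ℕ.≤-total s r)
    where
    wlog : ∀ {r s} → s ℕ.≤ r → r ℕ.< k → + r ≡ + s mod k → r ≡ s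
    wlog {r} {s} s≤r r<k (mk≡mod k∣r-s) = ℕ.≤-antisym (ℕ.m∸n≡0⇒m≤n r∸s≡0) s≤r
      where
      k∣r∸s : k ∣ r ℕ.∸ s
      k∣r∸s = ∣⇒∣ᵤ (subst (+ k ∣ℤ_) (≡.trans (m-n≡m⊖n r s) (⊖-≥ s≤r)) k∣r-s)
      r∸s≡0 : r ℕ.∸ s ≡ 0
      r∸s≡0 = ≡.trans (≡.sym (m<n⇒m%n≡m (ℕ.≤-<-trans (ℕ.m∸n≤m r s) r<k)))
                      (n∣m⇒m%n≡0 _ k k∣r∸s)

  %ℕ-≡mod : ∀ a → + (a %ℕ k) ≡ a mod k
  %ℕ-≡mod a = mk≡mod (divides (- (a /ℕ k))
    (≡.trans (cong (λ b → + (a %ℕ k) - b) (a≡a%ℕn+[a/ℕn]*n a k))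
             (cancel (+ (a %ℕ k)) (a /ℕ k) (+ k))))
    where
    cancel : ∀ r q k → r - (r + q * k) ≡ (- q) * k
    cancel = solve-∀

  ≡mod⇒%ℕ≡ : ∀ {a b} → a ≡ b mod k → a %ℕ k ≡ b %ℕ k
  ≡mod⇒%ℕ≡ {a} {b} a≡b = ≡mod⇒≡ (n%ℕd<d a k) (n%ℕd<d b k)
    (≡mod-trans (%ℕ-≡mod a) (≡mod-trans a≡b (≡mod-sym (%ℕ-≡mod b))))

  residue : ℤ → Fin k
  residue a = fromℕ< (n%ℕd<d a k)

  toℕ-residue : ∀ a → toℕ (residue a) ≡ a %ℕ k
  toℕ-residue a = toℕ-fromℕ< (n%ℕd<d a k)

  residue-toℕ : ∀ i → residue (+ toℕ i) ≡ i
  residue-toℕ i = toℕ-injective (≡.trans (toℕ-residue (+ toℕ i)) (m<n⇒m%n≡m (toℕ<n i)))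

  residue-cong : ∀ {a b} → a ≡ b mod k → residue a ≡ residue b
  residue-cong a≡b = fromℕ<-cong _ _ (≡mod⇒%ℕ≡ a≡b) _ _

  residue-+ : ∀ a b → (toℕ (residue a) ℕ.+ toℕ (residue b)) % k ≡ toℕ (residue (a + b))
  residue-+ a b = begin
    (toℕ (residue a) ℕ.+ toℕ (residue b)) % k
      ≡⟨ cong₂ (λ m n → (m ℕ.+ n) % k) (toℕ-residue a) (toℕ-residue b) ⟩
    + (a %ℕ k ℕ.+ b %ℕ k) %ℕ k               ≡⟨ ≡mod⇒%ℕ≡ sum-of-residues ⟩
    (a + b) %ℕ k                              ≡⟨ toℕ-residue (a + b) ⟨
    toℕ (residue (a + b))                     ∎
    where
    open ≡.≡-Reasoning
    sum-of-residues : + (a %ℕ k ℕ.+ b %ℕ k) ≡ a + b mod k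
    sum-of-residues =
      ≡mod-trans (≡mod-reflexive (pos-+ (a %ℕ k) (b %ℕ k))) (≡mod-+ (%ℕ-≡mod a) (%ℕ-≡mod b))

coprime⇒invertible : ∀ {a k} → gcd a k ≡ 1 → ∃[ s ] s * + a ≡ 1ℤ mod k
coprime⇒invertible {a} {k} gcd≡1 with coprime-Bézout (gcd≡1⇒coprime {a} {k} gcd≡1)
... | Bézout.+- x y 1+yk≡xa = + x , mk≡mod (divides (+ y) (begin
  + x * + a - 1ℤ            ≡⟨ cong (_- 1ℤ) (pos-* x a) ⟨
  + (x ℕ.* a) - 1ℤ          ≡⟨ cong (λ n → + n - 1ℤ) 1+yk≡xa ⟨
  (1ℤ + + (y ℕ.* k)) - 1ℤ   ≡⟨ [1+b]-1≡b (+ (y ℕ.* k)) ⟩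
  + (y ℕ.* k)               ≡⟨ pos-* y k ⟩
  + y * + k                 ∎))
  where
  open ≡.≡-Reasoning
  [1+b]-1≡b : ∀ b → (1ℤ + b) - 1ℤ ≡ b
  [1+b]-1≡b = solve-∀
... | Bézout.-+ x y 1+xa≡yk = - + x , mk≡mod (divides (- + y) (begin
  - + x * + a - 1ℤ          ≡⟨ [-x]a-1≡-[1+xa] (+ x) (+ a) ⟩
  - (1ℤ + + x * + a)        ≡⟨ cong (λ b → - (1ℤ + b)) (pos-* x a) ⟨
  - + (1 ℕ.+ x ℕ.* a)       ≡⟨ cong (λ n → - + n) 1+xa≡yk ⟩
  - + (y ℕ.* k)             ≡⟨ cong -_ (pos-* y k) ⟩
  - (+ y * + k)             ≡⟨ neg-distribˡ-* (+ y) (+ k) ⟩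
  - + y * + k               ∎))
  where
  open ≡.≡-Reasoning
  [-x]a-1≡-[1+xa] : ∀ x a → - x * a - 1ℤ ≡ - (1ℤ + x * a)
  [-x]a-1≡-[1+xa] = solve-∀

module _ {a ℓ} {A : Set a} {R : Rel A ℓ} where

  iterate-shift : (f : ℤ → A) (g : ℤ) → (∀ x → Star R (f x) (f (x - g))) →
                  ∀ t x → Star R (f x) (f (x - + t * g))
  iterate-shift f g shift ℕ.zero x = subst (Star R (f x) ∘ f) (x-0g≡x x g) ε
    where
    x-0g≡x : ∀ x g → x ≡ x - 0ℤ * g
    x-0g≡x = solve-∀
  iterate-shift f g shift (ℕ.suc t) x =
    shift x ◅◅ subst (Star R (f (x - g)) ∘ f) ([x-g]-tg≡x-[1+t]g x g (+ t))
                     (iterate-shift f g shift t (x - g))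
    where
    [x-g]-tg≡x-[1+t]g : ∀ x g t → (x - g) - t * g ≡ x - (1ℤ + t) * g
    [x-g]-tg≡x-[1+t]g = solve-∀

  unit-shift-connects : ∀ {k} .{{_ : NonZero k}} (f : Fin k → A) {g : ℤ} → gcd (g %ℕ k) k ≡ 1 →
                        (∀ x → Star R (f (residue x)) (f (residue (x - g)))) →
                        ∀ i j → Star R (f i) (f j)
  unit-shift-connects {k} f {g} g-unit shift i j with coprime⇒invertible {g %ℕ k} g-unit
  ... | s , sa≡1 =
    subst₂ (Star R) (cong f (residue-toℕ i)) (cong f (≡.trans (residue-cong x-tg≡y) (residue-toℕ j)))
      (iterate-shift (f ∘ residue) g shift t x)
    where
    x y : ℤ
    x = + toℕ i
    y = + toℕ j

    t : ℕ
    t = (s * (x - y)) %ℕ k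

    sg≡1 : s * g ≡ 1ℤ mod k
    sg≡1 = ≡mod-trans (≡mod-* (≡mod-refl {a = s}) (≡mod-sym (%ℕ-≡mod g))) sa≡1

    tg≡x-y : + t * g ≡ x - y mod k
    tg≡x-y = begin
      + t * g              ≈⟨ ≡mod-* (%ℕ-≡mod (s * (x - y))) (≡mod-refl {a = g}) ⟩
      s * (x - y) * g      ≡⟨ regroup s (x - y) g ⟩
      (x - y) * (s * g)    ≈⟨ ≡mod-* (≡mod-refl {a = x - y}) sg≡1 ⟩
      (x - y) * 1ℤ         ≡⟨ *-identityʳ (x - y) ⟩
      x - y                ∎
      where
      open import Relation.Binary.Reasoning.Setoid (≡mod-setoid {k})
      regroup : ∀ s d g → s * d * g ≡ d * (s * g)
      regroup = solve-∀

    x-tg≡y : x - + t * g ≡ y mod k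
    x-tg≡y = ≡mod-trans (≡mod-+ (≡mod-refl {a = x}) (≡mod-neg tg≡x-y))
                        (≡mod-reflexive (x-[x-y]≡y x y))
      where
      x-[x-y]≡y : ∀ x y → x - (x - y) ≡ y
      x-[x-y]≡y = solve-∀

endpoint : ∀ {a} {A : Set a} → A → List A → A
endpoint u []       = u
endpoint _ (v ∷ vs) = endpoint v vs

endpoint-snoc : ∀ {a} {A : Set a} (u : A) vs v → endpoint u (vs ++ [ v ]) ≡ v
endpoint-snoc u []       v = refl
endpoint-snoc u (w ∷ vs) v = endpoint-snoc w vs v

module CrossCover (G : Graph) (k : ℕ) .{{_ : NonZero k}} (W : Weight G k) where

  infix 4 _~_ _⇝_

  _~_ _⇝_ : V G × Fin k → V G × Fin k → Set
  _~_ = CrossAdj G k W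
  _⇝_ = Star _~_

  weight : V G → V G → ℤ
  weight u v = + toℕ (ω W u v)

  ~-sym : Symmetric _~_
  ~-sym {u , i} {v , j} (uv , i+j≡ω) = subst T (sym G u v) uv , (begin
    (toℕ j ℕ.+ toℕ i) % k ≡⟨ cong (_% k) (ℕ.+-comm (toℕ j) (toℕ i)) ⟩
    (toℕ i ℕ.+ toℕ j) % k ≡⟨ i+j≡ω ⟩
    toℕ (ω W u v)         ≡⟨ cong toℕ (ω-sym W u v uv) ⟩
    toℕ (ω W v u)         ∎)
    where open ≡.≡-Reasoning

  ⇝-sym : Symmetric _⇝_
  ⇝-sym = reverse (λ {x} {y} → ~-sym {x} {y})

  ⇝-residue-cong : ∀ {p v a b} → a ≡ b → p ⇝ (v , residue a) → p ⇝ (v , residue b)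
  ⇝-residue-cong {p} {v} = subst (λ y → p ⇝ (v , residue y))

  ~-step : ∀ {u v} → Adj G u v → ∀ x → (u , residue x) ~ (v , residue (weight u v - x))
  ~-step {u} {v} uv x = uv , (begin
    (toℕ (residue x) ℕ.+ toℕ (residue (weight u v - x))) % k ≡⟨ residue-+ x (weight u v - x) ⟩
    toℕ (residue (x + (weight u v - x)))  ≡⟨ cong (toℕ ∘ residue) (x+[w-x]≡w x (weight u v)) ⟩
    toℕ (residue (weight u v))            ≡⟨ cong toℕ (residue-toℕ (ω W u v)) ⟩
    toℕ (ω W u v)                         ∎)
    where
    open ≡.≡-Reasoning
    x+[w-x]≡w : ∀ x w → x + (w - x) ≡ w
    x+[w-x]≡w = solve-∀

  liftWalk : ∀ {u v} → Star (Adj G) u v → ∀ i → ∃[ j ] (u , i) ⇝ (v , j)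
  liftWalk ε i = i , ε
  liftWalk {u} (_◅_ {j = w} uw walk) i with liftWalk walk (residue (weight u w - + toℕ i))
  ... | j , lifted = j , first-edge ◅ lifted
    where
    first-edge : (u , i) ~ (w , residue (weight u w - + toℕ i))
    first-edge = subst (λ i′ → (u , i′) ~ (w , residue (weight u w - + toℕ i)))
                       (residue-toℕ i) (~-step uw (+ toℕ i))

  liftEvenWalk : ∀ {u us} → Linked (Adj G) (u ∷ us) → 2 ∣ length us → ∀ x →
                 (u , residue x) ⇝ (endpoint u us , residue (x - walkWeight W (u ∷ us)))
  liftEvenWalk {us = []}     _ _   x = ⇝-residue-cong (≡.sym (+-identityʳ x)) ε
  liftEvenWalk {us = _ ∷ []} _ 2∣1 _ = contradiction (∣1⇒≡1 2∣1) λ ()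
  liftEvenWalk {u} {v ∷ w ∷ us} (uv ∷ vw ∷ walk) 2∣len x =
    ~-step uv x ◅ ~-step vw (weight u v - x) ◅
    ⇝-residue-cong (two-steps x (weight u v) (weight v w) (walkWeight W (w ∷ us)))
      (liftEvenWalk walk (∣m+n∣m⇒∣n 2∣len ∣-refl) (weight v w - (weight u v - x)))
    where
    two-steps : ∀ x a b c → (b - (a - x)) - c ≡ x - (a - (b - c))
    two-steps = solve-∀

  liftCycle : ∀ {m} (C : Cycle G m) → 2 ∣ m → ∀ x →
              (start C , residue x) ⇝ (start C , residue (x - walkWeight W (closedWalk C)))
  liftCycle {m} C 2∣m x =
    subst (λ v → (start C , residue x) ⇝ (v , residue (x - walkWeight W (closedWalk C))))
          (endpoint-snoc (start C) (inner C) (start C))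
          (liftEvenWalk (isWalk C) (subst (2 ∣_) (≡.sym closedWalk-length) 2∣m) x)
    where
    closedWalk-length : length (inner C ++ [ start C ]) ≡ m
    closedWalk-length = ≡.trans (length-++ (inner C)) (≡.trans (ℕ.+-comm (length (inner C)) 1) (len C))

lemma3p5 : (G : Graph) → Connected G → (k : ℕ) → .{{_ : NonZero k}} →
    (W : Weight G k) → (m : ℕ) → (C : Cycle G m) → 2 ∣ m →
    gcd (walkWeight W (closedWalk C) %ℕ k) k ≡ 1 →
    ConnectedRel (CrossAdj G k W)
lemma3p5 G connected k W m C 2∣m coprime (u , i) (v , j) =
  let open CrossCover G k W
      h = start C
      i′ , u⇝h = liftWalk (connected u h) i
      j′ , v⇝h = liftWalk (connected v h) j
  in u⇝h ◅◅ unit-shift-connects (h ,_) coprime (liftCycle C 2∣m) i′ j′ ◅◅ ⇝-sym v⇝h
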